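{- Let $n\ge5$. The number of topdrop-valid necklaces in $S_n$ of the form $[a,b,c,n-1,c,b,a,n]$ with $a,b,c$ pairwise distinct natural numbers, $1\le a,b,c\le n-2$, $a+b+c\ne n-1$, $a+b\ne n-1$ and $b+c\ne n-1$, is at least: $n^3-\tfrac{23}{2}n^2+42n-46$ if $n\equiv0$ or $2\pmod 6$; $n^3-\tfrac{23}{2}n^2+44n-\tfrac{115}{2}$ if $n\equiv1\pmod 6$; $n^3-\tfrac{23}{2}n^2+44n-\tfrac{111}{2}$ if $n\equiv3$ or $5\pmod 6$; $n^3-\tfrac{23}{2}n^2+42n-48$ if $n\equiv4\pmod 6$.
   Context: Permutations are in one-line notation $\pi=\pi_1\cdots\pi_n$. The topdrop map $T:S_n\to S_n$ is $T(\pi_1\cdots\pi_n)=\pi_{\pi_1+1}\cdots\pi_n\,\pi_{\pi_1}\pi_{\pi_1-1}\cdots\pi_1$ (first $\pi_1$ entries removed, reversed, appended at the end); it is a bijection. The topdrop-necklace of $\pi$ is the cyclic sequence $[\pi_1,T(\pi)_1,\dots,T^{s-1}(\pi)_1]$, where $s\ge1$ is minimal with $T^s(\pi)=\pi$, considered up to cyclic rotation. A necklace is topdrop-valid in $S_n$ if it is the topdrop-necklace of some $\pi\in S_n$. -}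

module Defs where

open import Data.Nat using (ℕ; zero; suc; _+_; _*_; _∸_; _≤_; _<_; _%_)
open import Data.Integer as ℤ using (ℤ; +_; -_)
open import Data.List using (List; []; _∷_; _++_; take; drop; reverse; upTo; map; length)
open import Data.List.Relation.Binary.Permutation.Propositional using (_↭_)
open import Data.Product using (Σ; ∃; _×_; _,_)
open import Relation.Binary.PropositionalEquality using (_≡_; _≢_)
open import Relation.Nullary using (¬_)

IsPerm : ℕ → List ℕ → Set
IsPerm n π = π ↭ map suc (upTo n)

topdrop : List ℕ → List ℕ
topdrop [] = []
topdrop (x ∷ xs) = drop x (x ∷ xs) ++ reverse (take x (x ∷ xs))

iterate : ℕ → List ℕ → List ℕ
iterate zero π = π
iterate (suc k) π = iterate k (topdrop π)

-- first entry (0 for the empty list; never used on permutations with n ≥ 1)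
first : List ℕ → ℕ
first [] = 0
first (x ∷ _) = x

firsts : ℕ → List ℕ → List ℕ
firsts zero π = []
firsts (suc s) π = first π ∷ firsts s (topdrop π)

IsPeriod : List ℕ → ℕ → Set
IsPeriod π s = (1 ≤ s) × (iterate s π ≡ π) × (∀ t → 1 ≤ t → t < s → iterate t π ≢ π)

rotate : ℕ → List ℕ → List ℕ
rotate k L = drop k L ++ take k L

SameNecklace : List ℕ → List ℕ → Set
SameNecklace L N = ∃ λ k → (k < length L) × (rotate k L ≡ N)

-- N (a cyclic sequence, given by a representative) is the topdrop-necklace of π
IsTopdropNecklace : List ℕ → List ℕ → Set
IsTopdropNecklace π N = ∃ λ s → IsPeriod π s × SameNecklace (firsts s π) N

TopdropValid : ℕ → List ℕ → Set
TopdropValid n N = ∃ λ π → IsPerm n π × IsTopdropNecklace π N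

necklace : ℕ → ℕ → ℕ → ℕ → List ℕ
necklace n a b c = a ∷ b ∷ c ∷ (n ∸ 1) ∷ c ∷ b ∷ a ∷ n ∷ []

Admissible : ℕ → ℕ → ℕ → ℕ → Set
Admissible n a b c =
  (1 ≤ a) × (a ≤ n ∸ 2) × (1 ≤ b) × (b ≤ n ∸ 2) × (1 ≤ c) × (c ≤ n ∸ 2) ×
  (a ≢ b) × (b ≢ c) × (a ≢ c) ×
  (a + b + c ≢ n ∸ 1) × (a + b ≢ n ∸ 1) × (b + c ≢ n ∸ 1)

-- twice the lower bound of the paper (to stay integral), by n mod 6
twiceLowerBound : ℕ → ℤ
twiceLowerBound n = go (n % 6)
  where
  N : ℤ
  N = + n
  base : ℤ
  base = ℤ._-_ (+ 2 ℤ.* (N ℤ.* N ℤ.* N)) (+ 23 ℤ.* (N ℤ.* N))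
  go : ℕ → ℤ
  go 0 = ℤ._-_ (base ℤ.+ + 84 ℤ.* N) (+ 92)
  go 1 = ℤ._-_ (base ℤ.+ + 88 ℤ.* N) (+ 115)
  go 2 = ℤ._-_ (base ℤ.+ + 84 ℤ.* N) (+ 92)
  go 3 = ℤ._-_ (base ℤ.+ + 88 ℤ.* N) (+ 111)
  go 4 = ℤ._-_ (base ℤ.+ + 84 ℤ.* N) (+ 96)
  go _ = ℤ._-_ (base ℤ.+ + 88 ℤ.* N) (+ 111)

-- If π starts with n then T π = reverse π, and on lists with positive first entry T ∘ reverse ∘ T = reverse.
-- So if z = reverse π is such that T³ z starts with n − 1 (and is therefore reversed by T), the orbit of π is
-- π, z, T z, T² z, T³ z, reverse (T³ z), reverse (T² z), reverse (T z), π, with first entries the palindrome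
-- n, a, b, c, n − 1, c, b, a; every entry but the first is below n, so the period is exactly 8.
-- Following positions through T, this asks z to take the values a, b, c, n − 1, n at five positions, which
-- are distinct precisely by the admissibility conditions, and such values extend to a permutation by transpositions.
-- For the count, with m = n − 2, the admissible triples are those of [1, m]³ outside six families: a = b (m²),
-- b = c ≠ a and a = c ≠ b (m(m − 1) each), distinct with a + b = n − 1 or with b + c = n − 1 (2⌊m/2⌋(m − 2) each),
-- and distinct with a + b + c = n − 1 (counted recursively, by removing an entry 1 or lowering all entries by 1).
-- The resulting lower bound is exactly the paper's, as checked on each residue class of n modulo 6.

module Submission where

open import Defs
open import Function using (_∘_)
open import Data.Bool using (true; false; if_then_else_; T)
open import Data.Bool.Properties using (if-float)
open import Data.Empty using (⊥-elim)
open import Data.Nat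
open import Data.Nat.Properties
open import Data.Nat.DivMod using (_/_; m%n<n; m≡m%n+[m/n]*n; [m+kn]%n≡m%n)
open import Data.Nat.Tactic.RingSolver using (solve-∀; solve)
open import Data.Integer as ℤ using (ℤ; +_)
import Data.Integer.Properties as ℤ
import Data.Integer.Tactic.RingSolver as ℤ-Solver
open import Data.List using (List; [_]; []; _∷_; _++_; take; drop; reverse; applyUpTo; applyDownFrom; length; map; filter; concat; concatMap; cartesianProduct)
open import Data.List.Properties
  using (reverse-++; reverse-involutive; length-reverse; length-applyUpTo; ∷-injectiveʳ; reverse-applyUpTo; map-upTo;
         length-take; length-drop; take++drop≡id; length-++; length-map; length-filter; ++-identityʳ)
open import Data.List.Membership.Propositional using (_∈_; lose)
open import Data.List.Membership.Propositional.Properties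
  using (∈-applyUpTo⁺; ∈-applyUpTo⁻; ∈-∃++; ∈-concat⁺; ∈-++⁺ˡ; ∈-++⁺ʳ; ∈-++⁻; ∈-map⁺; ∈-concatMap⁺; ∈-filter⁺; ∈-filter⁻;
         ∈-cartesianProduct⁺; ∈-cartesianProduct⁻)
open import Data.List.Relation.Binary.Permutation.Propositional
  using (_↭_; prep; swap; ↭-refl; ↭-sym; ↭-trans; ↭-reflexive; module PermutationReasoning)
open import Data.List.Relation.Binary.Permutation.Propositional.Properties using (∈-resp-↭; ↭-reverse) renaming (shift to ↭-shift)
open import Data.List.Relation.Binary.Subset.Propositional using (_⊆_)
open import Data.List.Relation.Unary.Any using (Any; here; there)
open import Data.List.Relation.Unary.All using (All; []; _∷_)
import Data.List.Relation.Unary.All as All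
open import Data.List.Relation.Unary.All.Properties using (map⁻; all-filter)
open import Data.List.Relation.Unary.Unique.Propositional using (Unique; []; _∷_)
open import Data.List.Relation.Unary.Unique.Propositional.Properties using (++⁺; filter⁺; applyUpTo⁺₁; cartesianProduct⁺)
open import Data.Product using (∃; _×_; _,_; proj₁; proj₂)
open import Data.Sum using (_⊎_; inj₁; inj₂)
open import Relation.Binary using (tri<; tri≈; tri>)
open import Relation.Binary.PropositionalEquality
  using (_≡_; _≢_; refl; sym; trans; cong; cong₂; subst; subst₂; ≢-sym; module ≡-Reasoning)
open import Relation.Nullary using (¬_; yes; no; ¬?; contradiction)
open import Relation.Nullary.Decidable using (dec-true; dec-false; _×-dec_)
open import Relation.Unary using (Decidable)

-- Topdrop on tabulated lists

applyUpTo-cong : ∀ {A : Set} {f g : ℕ → A} n → (∀ i → i < n → f i ≡ g i) → applyUpTo f n ≡ applyUpTo g n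
applyUpTo-cong zero f≗g = refl
applyUpTo-cong (suc n) f≗g = cong₂ _∷_ (f≗g 0 z<s) (applyUpTo-cong n (λ i i<n → f≗g (suc i) (s<s i<n)))

applyUpTo-++ : ∀ {A : Set} (g h : ℕ → A) m j →
  applyUpTo g m ++ applyUpTo h j ≡ applyUpTo (λ i → if i <ᵇ m then g i else h (i ∸ m)) (m + j)
applyUpTo-++ g h zero j = refl
applyUpTo-++ g h (suc m) j = cong (g 0 ∷_) (applyUpTo-++ (g ∘ suc) h m j)

drop-applyUpTo : ∀ {A : Set} (f : ℕ → A) k n → drop k (applyUpTo f n) ≡ applyUpTo (λ i → f (k + i)) (n ∸ k)
drop-applyUpTo f zero n = refl
drop-applyUpTo f (suc k) zero = refl
drop-applyUpTo f (suc k) (suc n) = drop-applyUpTo (f ∘ suc) k n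

take-applyUpTo : ∀ {A : Set} (f : ℕ → A) {k n} → k ≤ n → take k (applyUpTo f n) ≡ applyUpTo f k
take-applyUpTo f z≤n = refl
take-applyUpTo f (s≤s k≤n) = cong (f 0 ∷_) (take-applyUpTo (f ∘ suc) k≤n)

drop-length-++ : ∀ {A : Set} (ys : List A) {zs k} → length ys ≡ k → drop k (ys ++ zs) ≡ zs
drop-length-++ [] refl = refl
drop-length-++ (y ∷ ys) refl = drop-length-++ ys refl

take-length-++ : ∀ {A : Set} (ys : List A) {zs k} → length ys ≡ k → take k (ys ++ zs) ≡ ys
take-length-++ [] refl = refl
take-length-++ (y ∷ ys) refl = cong (y ∷_) (take-length-++ ys refl)

reverse-applyUpTo-reindex : ∀ {A : Set} (f : ℕ → A) k → reverse (applyUpTo f k) ≡ applyUpTo (λ i → f (k ∸ suc i)) k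
reverse-applyUpTo-reindex f k = trans (reverse-applyUpTo f k) (applyDownFrom-applyUpTo k)
  where
  applyDownFrom-applyUpTo : ∀ k → applyDownFrom f k ≡ applyUpTo (λ i → f (k ∸ suc i)) k
  applyDownFrom-applyUpTo zero = refl
  applyDownFrom-applyUpTo (suc k) = cong (f k ∷_) (applyDownFrom-applyUpTo k)

topdrop-unfold : ∀ {w x} → first w ≡ x → topdrop w ≡ drop x w ++ reverse (take x w)
topdrop-unfold {[]} refl = refl
topdrop-unfold {y ∷ ys} refl = refl

-- Position i of T π holds the entry of π at position topdropIndex n k i, where n = |π| and k = π₁.
topdropIndex : ℕ → ℕ → ℕ → ℕ
topdropIndex n k i = if i <ᵇ n ∸ k then k + i else k ∸ suc (i ∸ (n ∸ k))

topdrop-applyUpTo : ∀ (f : ℕ → ℕ) {n k} → f 0 ≡ k → k ≤ n →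
  topdrop (applyUpTo f n) ≡ applyUpTo (f ∘ topdropIndex n k) n
topdrop-applyUpTo f {zero} f0≡k k≤n = refl
topdrop-applyUpTo f {n@(suc _)} {k} f0≡k k≤n = begin
  topdrop (applyUpTo f n)
    ≡⟨ topdrop-unfold f0≡k ⟩
  drop k (applyUpTo f n) ++ reverse (take k (applyUpTo f n))
    ≡⟨ cong₂ _++_ (drop-applyUpTo f k n) (trans (cong reverse (take-applyUpTo f k≤n)) (reverse-applyUpTo-reindex f k)) ⟩
  applyUpTo (λ i → f (k + i)) (n ∸ k) ++ applyUpTo (λ i → f (k ∸ suc i)) k
    ≡⟨ applyUpTo-++ _ _ (n ∸ k) k ⟩
  applyUpTo (λ i → if i <ᵇ n ∸ k then f (k + i) else f (k ∸ suc (i ∸ (n ∸ k)))) (n ∸ k + k)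
    ≡⟨ cong (applyUpTo _) (m∸n+n≡m k≤n) ⟩
  applyUpTo (λ i → if i <ᵇ n ∸ k then f (k + i) else f (k ∸ suc (i ∸ (n ∸ k)))) n
    ≡⟨ applyUpTo-cong n (λ i _ → sym (if-float f (i <ᵇ n ∸ k) {k + i} {k ∸ suc (i ∸ (n ∸ k))})) ⟩
  applyUpTo (f ∘ topdropIndex n k) n ∎
  where open ≡-Reasoning

topdropIndex-< : ∀ {n k i} → i < n ∸ k → topdropIndex n k i ≡ k + i
topdropIndex-< {n} {k} {i} i<n∸k rewrite dec-true (i <? n ∸ k) i<n∸k = refl

topdropIndex-≥ : ∀ {n k i} → k ≤ n → n ∸ k ≤ i → topdropIndex n k i ≡ n ∸ suc i
topdropIndex-≥ {n} {k} {i} k≤n n∸k≤i rewrite dec-false (i <? n ∸ k) (≤⇒≯ n∸k≤i) = begin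
  k ∸ suc j                 ≡⟨ cong (_∸ suc j) (sym (m∸[m∸n]≡n k≤n)) ⟩
  n ∸ (n ∸ k) ∸ suc j       ≡⟨ ∸-+-assoc n (n ∸ k) (suc j) ⟩
  n ∸ (n ∸ k + suc j)       ≡⟨ cong (n ∸_) (+-suc (n ∸ k) j) ⟩
  n ∸ suc (n ∸ k + j)       ≡⟨ cong (λ t → n ∸ suc t) (m+[n∸m]≡n n∸k≤i) ⟩
  n ∸ suc i                 ∎
  where
  j : ℕ
  j = i ∸ (n ∸ k)
  open ≡-Reasoning

n∸suc-< : ∀ {n k i} → n ∸ k ≤ i → i < n → n ∸ suc i < k
n∸suc-< {n} {k} {i} n∸k≤i i<n = +-cancelʳ-< (suc i) (n ∸ suc i) k (begin-strict
  n ∸ suc i + suc i   ≡⟨ m∸n+n≡m i<n ⟩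
  n                   ≤⟨ m≤n+m∸n n k ⟩
  k + (n ∸ k)         ≤⟨ +-monoʳ-≤ k n∸k≤i ⟩
  k + i               <⟨ +-monoʳ-< k (n<1+n i) ⟩
  k + suc i           ∎)
  where open ≤-Reasoning

topdropIndex<n : ∀ {n k i} → k ≤ n → i < n → topdropIndex n k i < n
topdropIndex<n {n} {k} {i} k≤n i<n with i <? n ∸ k
... | yes i<n∸k = begin-strict
  topdropIndex n k i  ≡⟨ topdropIndex-< i<n∸k ⟩
  k + i               <⟨ +-monoʳ-< k i<n∸k ⟩
  k + (n ∸ k)         ≡⟨ m+[n∸m]≡n k≤n ⟩
  n                   ∎
  where open ≤-Reasoning
... | no i≮n∸k = begin-strict
  topdropIndex n k i  ≡⟨ topdropIndex-≥ k≤n (≮⇒≥ i≮n∸k) ⟩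
  n ∸ suc i           <⟨ n∸suc-< (≮⇒≥ i≮n∸k) i<n ⟩
  k                   ≤⟨ k≤n ⟩
  n                   ∎
  where open ≤-Reasoning

topdropIndex-injective : ∀ {n k i j} → k ≤ n → i < n → j < n → topdropIndex n k i ≡ topdropIndex n k j → i ≡ j
topdropIndex-injective {n} {k} {i} {j} k≤n i<n j<n eq with i <? n ∸ k | j <? n ∸ k
... | yes i< | yes j< = +-cancelˡ-≡ k i j (trans (sym (topdropIndex-< i<)) (trans eq (topdropIndex-< j<)))
... | no i≮ | no j≮ = suc-injective (∸-cancelˡ-≡ i<n j<n
  (trans (sym (topdropIndex-≥ k≤n (≮⇒≥ i≮))) (trans eq (topdropIndex-≥ k≤n (≮⇒≥ j≮)))))
... | yes i< | no j≮ = ⊥-elim (<⇒≢ (<-≤-trans (n∸suc-< (≮⇒≥ j≮) j<n) (m≤m+n k i))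
  (trans (sym (topdropIndex-≥ k≤n (≮⇒≥ j≮))) (trans (sym eq) (topdropIndex-< i<))))
... | no i≮ | yes j< = ⊥-elim (<⇒≢ (<-≤-trans (n∸suc-< (≮⇒≥ i≮) i<n) (m≤m+n k j))
  (trans (sym (topdropIndex-≥ k≤n (≮⇒≥ i≮))) (trans eq (topdropIndex-< j<))))

topdropIndex-first : ∀ {n k} → k < n → topdropIndex n k 0 ≡ k
topdropIndex-first {n} {k} k<n = trans (topdropIndex-< (m<n⇒0<n∸m k<n)) (+-identityʳ k)

topdropIndex-last : ∀ {n k} → 1 ≤ k → k ≤ n → topdropIndex n k (n ∸ 1) ≡ 0
topdropIndex-last {zero} (s≤s z≤n) ()
topdropIndex-last {suc n} {k} 1≤k k≤n = trans (topdropIndex-≥ k≤n (∸-monoʳ-≤ (suc n) 1≤k)) (n∸n≡0 n)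

topdropIndex-top : ∀ {n k} → k < n → topdropIndex n k (n ∸ suc k) ≡ n ∸ 1
topdropIndex-top {suc n} {k} (s≤s k≤n) =
  trans (topdropIndex-< (∸-monoʳ-< (n<1+n k) (s≤s k≤n))) (m+[n∸m]≡n k≤n)

reverse-topdrop : ∀ x xs → reverse (topdrop (x ∷ xs)) ≡ take x (x ∷ xs) ++ reverse (drop x (x ∷ xs))
reverse-topdrop x xs = begin
  reverse (drop x w ++ reverse (take x w))             ≡⟨ reverse-++ (drop x w) _ ⟩
  reverse (reverse (take x w)) ++ reverse (drop x w)   ≡⟨ cong (_++ reverse (drop x w)) (reverse-involutive _) ⟩
  take x w ++ reverse (drop x w)                       ∎
  where
  w : List ℕ
  w = x ∷ xs
  open ≡-Reasoning

first-reverse-topdrop : ∀ w → 1 ≤ first w → first (reverse (topdrop w)) ≡ first w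
first-reverse-topdrop (suc x ∷ xs) _ = cong first (reverse-topdrop (suc x) xs)

topdrop≡reverse : ∀ w → length w ≤ suc (first w) → topdrop w ≡ reverse w
topdrop≡reverse [] _ = refl
topdrop≡reverse w@(x ∷ xs) |w|≤1+x = begin
  drop x w ++ reverse (take x w)             ≡⟨ cong (_++ reverse (take x w)) (sym (reverse-short (drop x w) |drop|≤1)) ⟩
  reverse (drop x w) ++ reverse (take x w)   ≡⟨ sym (reverse-++ (take x w) (drop x w)) ⟩
  reverse (take x w ++ drop x w)             ≡⟨ cong reverse (take++drop≡id x w) ⟩
  reverse w                                  ∎
  where
  open ≡-Reasoning
  reverse-short : ∀ (ys : List ℕ) → length ys ≤ 1 → reverse ys ≡ ys
  reverse-short [] _ = refl
  reverse-short (_ ∷ []) _ = refl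
  reverse-short (_ ∷ _ ∷ _) (s≤s ())
  |drop|≤1 : length (drop x w) ≤ 1
  |drop|≤1 = subst (_≤ 1) (sym (length-drop x w)) (m≤n+o⇒m∸n≤o (length w) x (subst (length w ≤_) (+-comm 1 x) |w|≤1+x))

topdrop-reverse-topdrop : ∀ w → 1 ≤ first w → topdrop (reverse (topdrop w)) ≡ reverse w
topdrop-reverse-topdrop w@(x@(suc _) ∷ xs) _ with x ≤? length w
... | yes x≤|w| = begin
  topdrop (reverse (topdrop w))                 ≡⟨ cong topdrop (reverse-topdrop x xs) ⟩
  topdrop (P ++ reverse D)                      ≡⟨ topdrop-unfold {P ++ reverse D} refl ⟩
  drop x (P ++ reverse D) ++ reverse (take x (P ++ reverse D))
    ≡⟨ cong₂ (λ u v → u ++ reverse v) (drop-length-++ P |P|≡x) (take-length-++ P |P|≡x) ⟩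
  reverse D ++ reverse P                        ≡⟨ sym (reverse-++ P D) ⟩
  reverse (P ++ D)                              ≡⟨ cong reverse (take++drop≡id x w) ⟩
  reverse w                                     ∎
  where
  open ≡-Reasoning
  P : List ℕ
  P = take x w
  D : List ℕ
  D = drop x w
  |P|≡x : length P ≡ x
  |P|≡x = trans (length-take x w) (m≤n⇒m⊓n≡m x≤|w|)
... | no x≰|w| = begin
  topdrop (reverse (topdrop w))   ≡⟨ cong (topdrop ∘ reverse) T≡R ⟩
  topdrop (reverse (reverse w))   ≡⟨ cong topdrop (reverse-involutive w) ⟩
  topdrop w                       ≡⟨ T≡R ⟩
  reverse w                       ∎
  where
  open ≡-Reasoning
  T≡R : topdrop w ≡ reverse w
  T≡R = topdrop≡reverse w (m≤n⇒m≤1+n (<⇒≤ (≰⇒> x≰|w|)))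

-- Permutations with prescribed values

transpose : ℕ → ℕ → ℕ → ℕ
transpose p q x = if x ≡ᵇ p then q else if x ≡ᵇ q then p else x

≡ᵇ-refl : ∀ x → (x ≡ᵇ x) ≡ true
≡ᵇ-refl x = dec-true (x ≟ x) refl

≢⇒≡ᵇ≡false : ∀ {x y} → x ≢ y → (x ≡ᵇ y) ≡ false
≢⇒≡ᵇ≡false {x} {y} = dec-false (x ≟ y)

≡ᵇ≡true⇒≡ : ∀ x y → (x ≡ᵇ y) ≡ true → x ≡ y
≡ᵇ≡true⇒≡ x y eq = ≡ᵇ⇒≡ x y (subst T (sym eq) _)

transpose-left : ∀ p q → transpose p q p ≡ q
transpose-left p q rewrite ≡ᵇ-refl p = refl

transpose-right : ∀ p q → transpose p q q ≡ p
transpose-right p q with q ≡ᵇ p in eq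
... | true = ≡ᵇ≡true⇒≡ q p eq
... | false rewrite ≡ᵇ-refl q = refl

transpose-other : ∀ {p q x} → x ≢ p → x ≢ q → transpose p q x ≡ x
transpose-other x≢p x≢q rewrite ≢⇒≡ᵇ≡false x≢p | ≢⇒≡ᵇ≡false x≢q = refl

transpose-same : ∀ p x → transpose p p x ≡ x
transpose-same p x with x ≡ᵇ p in eq
... | true = sym (≡ᵇ≡true⇒≡ x p eq)
... | false = refl

transpose-comm : ∀ p q x → transpose p q x ≡ transpose q p x
transpose-comm p q x with x ≡ᵇ p in eq₁ | x ≡ᵇ q in eq₂
... | true | true = trans (sym (≡ᵇ≡true⇒≡ x q eq₂)) (≡ᵇ≡true⇒≡ x p eq₁)
... | true | false = refl
... | false | true = refl
... | false | false = refl

transpose-suc : ∀ p q i → transpose (suc p) (suc q) (suc i) ≡ suc (transpose p q i)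
transpose-suc p q i with i ≡ᵇ p
... | true = refl
... | false with i ≡ᵇ q
... | true = refl
... | false = refl

applyUpTo-split : ∀ {A : Set} (h : ℕ → A) q r →
  applyUpTo h (q + suc r) ≡ applyUpTo h q ++ h q ∷ applyUpTo (λ i → h (suc (q + i))) r
applyUpTo-split h zero r = refl
applyUpTo-split h (suc q) r = cong (h 0 ∷_) (applyUpTo-split (h ∘ suc) q r)

∷-++-∷-↭ : ∀ {A : Set} (x y : A) xs ys → x ∷ xs ++ y ∷ ys ↭ y ∷ xs ++ x ∷ ys
∷-++-∷-↭ x y xs ys = begin
  x ∷ xs ++ y ∷ ys       ↭⟨ prep x (↭-shift y xs ys) ⟩
  x ∷ y ∷ xs ++ ys       ↭⟨ swap x y ↭-refl ⟩
  y ∷ x ∷ xs ++ ys       ↭⟨ prep y (↭-sym (↭-shift x xs ys)) ⟩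
  y ∷ xs ++ x ∷ ys       ∎
  where open PermutationReasoning

applyUpTo-transpose-↭ : ∀ (f : ℕ → ℕ) n {p q} → p < q → q < n → applyUpTo (f ∘ transpose p q) n ↭ applyUpTo f n
applyUpTo-transpose-↭ f (suc n) {suc p} {suc q} (s<s p<q) (s<s q<n) = prep (f 0) (begin
  applyUpTo (f ∘ transpose (suc p) (suc q) ∘ suc) n   ≡⟨ applyUpTo-cong n (λ i _ → cong f (transpose-suc p q i)) ⟩
  applyUpTo (f ∘ suc ∘ transpose p q) n               ↭⟨ applyUpTo-transpose-↭ (f ∘ suc) n p<q q<n ⟩
  applyUpTo (f ∘ suc) n                               ∎)
  where open PermutationReasoning
applyUpTo-transpose-↭ f (suc n) {zero} {suc q} z<s (s<s q<n) = begin
  applyUpTo (f ∘ transpose 0 (suc q)) (suc n)           ≡⟨ cong (λ k → applyUpTo g (suc k)) n≡q+1+r ⟩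
  f (suc q) ∷ applyUpTo (g ∘ suc) (q + suc r)           ≡⟨ cong (f (suc q) ∷_) (applyUpTo-split (g ∘ suc) q r) ⟩
  f (suc q) ∷ applyUpTo (g ∘ suc) q ++ g (suc q) ∷ applyUpTo (λ i → g (suc (suc (q + i)))) r
    ≡⟨ cong (f (suc q) ∷_) (cong₂ _++_ (applyUpTo-cong q (λ i i<q → cong f (transpose-other {0} (λ ()) (<⇒≢ (s<s i<q)))))
                                        (cong₂ _∷_ (cong f (transpose-right 0 (suc q)))
                                                   (applyUpTo-cong r (λ i _ → cong f (transpose-other {0} (λ ()) (>⇒≢ (s<s (s≤s (m≤m+n q i))))))))) ⟩
  f (suc q) ∷ applyUpTo (f ∘ suc) q ++ f 0 ∷ applyUpTo (λ i → f (suc (suc (q + i)))) r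
    ↭⟨ ∷-++-∷-↭ (f (suc q)) (f 0) _ _ ⟩
  f 0 ∷ applyUpTo (f ∘ suc) q ++ f (suc q) ∷ applyUpTo (λ i → f (suc (suc (q + i)))) r
    ≡⟨ cong (f 0 ∷_) (sym (applyUpTo-split (f ∘ suc) q r)) ⟩
  applyUpTo f (suc (q + suc r))                          ≡⟨ cong (λ k → applyUpTo f (suc k)) (sym n≡q+1+r) ⟩
  applyUpTo f (suc n)                                    ∎
  where
  open PermutationReasoning
  g : ℕ → ℕ
  g = f ∘ transpose 0 (suc q)
  r : ℕ
  r = n ∸ suc q
  n≡q+1+r : n ≡ q + suc r
  n≡q+1+r = sym (trans (+-suc q r) (m+[n∸m]≡n q<n))

IsPermFn : ℕ → (ℕ → ℕ) → Set
IsPermFn n σ = IsPerm n (applyUpTo σ n)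

transpose-preserves-IsPermFn : ∀ {n σ p q} → p < n → q < n → IsPermFn n σ → IsPermFn n (σ ∘ transpose p q)
transpose-preserves-IsPermFn {n} {σ} {p} {q} p<n q<n σ-perm with <-cmp p q
... | tri< p<q _ _ = ↭-trans (applyUpTo-transpose-↭ σ n p<q q<n) σ-perm
... | tri≈ _ refl _ = ↭-trans (↭-reflexive (applyUpTo-cong n (λ i _ → cong σ (transpose-same p i)))) σ-perm
... | tri> _ _ q<p = ↭-trans (↭-reflexive (applyUpTo-cong n (λ i _ → cong σ (transpose-comm p q i))))
                             (↭-trans (applyUpTo-transpose-↭ σ n q<p p<n) σ-perm)

-- Compose σ with the transposition of p and σ⁻¹(v).
prescribeOne : ∀ {n σ p v} → IsPermFn n σ → p < n → 1 ≤ v → v ≤ n →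
  ∃ λ σ′ → IsPermFn n σ′ × σ′ p ≡ v × (∀ p′ → p′ ≢ p → σ p′ ≢ v → σ′ p′ ≡ σ p′)
prescribeOne {n} {σ} {p} {suc v} σ-perm p<n _ v<n
  with q , q<n , v≡σq ← ∈-applyUpTo⁻ σ (∈-resp-↭ (↭-sym σ-perm) (subst (suc v ∈_) (sym (map-upTo suc n)) (∈-applyUpTo⁺ suc v<n)))
  = σ ∘ transpose p q , transpose-preserves-IsPermFn p<n q<n σ-perm , trans (cong σ (transpose-left p q)) (sym v≡σq) , unchanged
  where
  unchanged : ∀ p′ → p′ ≢ p → σ p′ ≢ suc v → σ (transpose p q p′) ≡ σ p′
  unchanged p′ p′≢p σp′≢v = cong σ (transpose-other p′≢p (λ p′≡q → σp′≢v (trans (cong σ p′≡q) (sym v≡σq))))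

prescribe : ∀ n (ps : List (ℕ × ℕ)) → Unique (map proj₁ ps) → Unique (map proj₂ ps) →
  All (λ (p , v) → p < n × 1 ≤ v × v ≤ n) ps →
  ∃ λ σ → IsPermFn n σ × All (λ (p , v) → σ p ≡ v) ps
prescribe n [] _ _ _ = suc , ↭-reflexive (sym (map-upTo suc n)) , []
prescribe n ((p , v) ∷ ps) (p∉ps ∷ ps-unique) (v∉ps ∷ vs-unique) ((p<n , 1≤v , v≤n) ∷ in-range)
  with σ , σ-perm , σ-ps ← prescribe n ps ps-unique vs-unique in-range
  with σ′ , σ′-perm , σ′p≡v , unchanged ← prescribeOne σ-perm p<n 1≤v v≤n
  = σ′ , σ′-perm , σ′p≡v ∷ All.zipWith kept (All.zip (map⁻ p∉ps , map⁻ v∉ps) , σ-ps)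
  where
  kept : ∀ {(p′ , v′) : ℕ × ℕ} → (p ≢ p′ × v ≢ v′) × σ p′ ≡ v′ → σ′ p′ ≡ v′
  kept ((p≢p′ , v≢v′) , σp′≡v′) =
    trans (unchanged _ (p≢p′ ∘ sym) (λ σp′≡v → v≢v′ (trans (sym σp′≡v) σp′≡v′))) σp′≡v′

-- Palindromic topdrop orbits

firsts-step : ∀ x {y v s L} → topdrop x ≡ y → first x ≡ v → firsts s y ≡ L → firsts (suc s) x ≡ v ∷ L
firsts-step _ refl refl refl = refl

first-iterate-∈-firsts : ∀ {t s} π → t < s → first (iterate t π) ∈ firsts s π
first-iterate-∈-firsts {zero} {suc s} π _ = here refl
first-iterate-∈-firsts {suc t} {suc s} π (s<s t<s) = there (first-iterate-∈-firsts (topdrop π) t<s)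

period-from-firsts : ∀ {π s} → iterate (suc s) π ≡ π → All (_< first π) (firsts s (topdrop π)) → IsPeriod π (suc s)
period-from-firsts {π} {s} Tˢπ≡π firsts<first = s≤s z≤n , Tˢπ≡π , not-earlier
  where
  not-earlier : ∀ t → 1 ≤ t → t < suc s → iterate t π ≢ π
  not-earlier (suc t) _ (s<s t<s) Tᵗπ≡π =
    <-irrefl (cong first Tᵗπ≡π) (All.lookup firsts<first (first-iterate-∈-firsts (topdrop π) t<s))

palindromic-orbit : ∀ z → let z₂ = iterate 1 z; z₃ = iterate 2 z; z₄ = iterate 3 z in
  1 ≤ first z → 1 ≤ first z₂ → 1 ≤ first z₃ → length z ≤ suc (first (reverse z)) → length z₄ ≤ suc (first z₄) →
  iterate 8 (reverse z) ≡ reverse z ×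
  firsts 8 (reverse z) ≡ first (reverse z) ∷ first z ∷ first z₂ ∷ first z₃ ∷ first z₄ ∷ first z₃ ∷ first z₂ ∷ first z ∷ []
palindromic-orbit z 1≤z 1≤z₂ 1≤z₃ |z|≤ |z₄|≤ = iterate-8 , firsts-8
  where
  open ≡-Reasoning
  z₂ z₃ z₄ : List ℕ
  z₂ = iterate 1 z
  z₃ = iterate 2 z
  z₄ = iterate 3 z
  step₁ : topdrop (reverse z) ≡ z
  step₁ = trans (topdrop≡reverse (reverse z) (subst (_≤ suc (first (reverse z))) (sym (length-reverse z)) |z|≤)) (reverse-involutive z)
  step₅ : topdrop z₄ ≡ reverse z₄
  step₅ = topdrop≡reverse z₄ |z₄|≤
  iterate-8 : iterate 8 (reverse z) ≡ reverse z
  iterate-8 = begin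
    iterate 8 (reverse z)    ≡⟨ cong (iterate 7) step₁ ⟩
    iterate 7 z              ≡⟨ cong (iterate 3) step₅ ⟩
    iterate 3 (reverse z₄)   ≡⟨ cong (iterate 2) (topdrop-reverse-topdrop z₃ 1≤z₃) ⟩
    iterate 2 (reverse z₃)   ≡⟨ cong (iterate 1) (topdrop-reverse-topdrop z₂ 1≤z₂) ⟩
    iterate 1 (reverse z₂)   ≡⟨ topdrop-reverse-topdrop z 1≤z ⟩
    reverse z                ∎
  firsts-8 : firsts 8 (reverse z) ≡
    first (reverse z) ∷ first z ∷ first z₂ ∷ first z₃ ∷ first z₄ ∷ first z₃ ∷ first z₂ ∷ first z ∷ []
  firsts-8 =
    firsts-step (reverse z) step₁ refl (firsts-step z refl refl (firsts-step z₂ refl refl (firsts-step z₃ refl refl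
    (firsts-step z₄ step₅ refl
    (firsts-step (reverse z₄) (topdrop-reverse-topdrop z₃ 1≤z₃) (first-reverse-topdrop z₃ 1≤z₃)
    (firsts-step (reverse z₃) (topdrop-reverse-topdrop z₂ 1≤z₂) (first-reverse-topdrop z₂ 1≤z₂)
    (firsts-step (reverse z₂) (topdrop-reverse-topdrop z 1≤z) (first-reverse-topdrop z 1≤z) refl)))))))

module Construction {n′ a b c : ℕ} (1≤a : 1 ≤ a) (1≤b : 1 ≤ b) (1≤c : 1 ≤ c) (a<n′ : a < n′) (b<n′ : b < n′) (c<n′ : c < n′)
  (a≢b : a ≢ b) (b≢c : b ≢ c) (a≢c : a ≢ c) (a+b+c≢n′ : a + b + c ≢ n′) (a+b≢n′ : a + b ≢ n′) (b+c≢n′ : b + c ≢ n′) where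

  n : ℕ
  n = suc n′

  a<n : a < n
  a<n = m<n⇒m<1+n a<n′
  b<n : b < n
  b<n = m<n⇒m<1+n b<n′
  c<n : c < n
  c<n = m<n⇒m<1+n c<n′
  n′<n : n′ < n
  n′<n = n<1+n n′
  n′∸a<n : n′ ∸ a < n
  n′∸a<n = s≤s (m∸n≤m n′ a)
  n′∸b<n : n′ ∸ b < n
  n′∸b<n = s≤s (m∸n≤m n′ b)

  τ : ℕ → ℕ → ℕ
  τ = topdropIndex n

  τ-injective : ∀ {k i j} → k < n → i < n → j < n → i ≢ j → τ k i ≢ τ k j
  τ-injective k<n i<n j<n i≢j = i≢j ∘ topdropIndex-injective (<⇒≤ k<n) i<n j<n

  q : ℕ
  q = τ b c

  q<n : q < n
  q<n = topdropIndex<n (<⇒≤ b<n) c<n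

  q≢n′ : q ≢ n′
  q≢n′ q≡n′ = τ-injective b<n c<n n′∸b<n c≢n′∸b (trans q≡n′ (sym (topdropIndex-top b<n)))
    where
    c≢n′∸b : c ≢ n′ ∸ b
    c≢n′∸b c≡ = b+c≢n′ (trans (cong (λ t → b + t) c≡) (m+[n∸m]≡n (<⇒≤ b<n′)))

  q≢0 : q ≢ 0
  q≢0 q≡0 = τ-injective b<n c<n n′<n (<⇒≢ c<n′) (trans q≡0 (sym (topdropIndex-last 1≤b (<⇒≤ b<n))))

  q≢b : q ≢ b
  q≢b q≡b = τ-injective b<n c<n z<s (≢-sym (<⇒≢ 1≤c)) (trans q≡b (sym (topdropIndex-first b<n)))

  q≢n′∸a : q ≢ n′ ∸ a
  q≢n′∸a q≡ with c <? n ∸ b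
  ... | yes c<n∸b = a+b+c≢n′ (begin
    a + b + c     ≡⟨ +-assoc a b c ⟩
    a + (b + c)   ≡⟨ cong (λ t → a + t) (trans (sym (topdropIndex-< c<n∸b)) q≡) ⟩
    a + (n′ ∸ a)  ≡⟨ m+[n∸m]≡n (<⇒≤ a<n′) ⟩
    n′            ∎)
    where open ≡-Reasoning
  ... | no c≮n∸b = a≢c (sym (∸-cancelˡ-≡ (<⇒≤ c<n′) (<⇒≤ a<n′) (trans (sym (topdropIndex-≥ (<⇒≤ b<n) (≮⇒≥ c≮n∸b))) q≡)))

  -- In z = σ 0 ∷ … ∷ σ n′, these are the positions whose entries T brings to the front of z, T z, T² z and T³ z,
  -- together with the last position, which starts reverse z.
  prescription : List (ℕ × ℕ)
  prescription = (0 , a) ∷ (a , b) ∷ (τ a b , c) ∷ (τ a q , n′) ∷ (n′ , n) ∷ []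

  positions-unique : Unique (map proj₁ prescription)
  positions-unique =
    (<⇒≢ 1≤a ∷ 0≢τab ∷ 0≢τaq ∷ <⇒≢ (<-trans 1≤a a<n′) ∷ []) ∷
    (a≢τab ∷ a≢τaq ∷ <⇒≢ a<n′ ∷ []) ∷
    (τ-injective a<n b<n q<n (≢-sym q≢b) ∷ τab≢n′ ∷ []) ∷
    (τaq≢n′ ∷ []) ∷ [] ∷ []
    where
    τa0≡a : τ a 0 ≡ a
    τa0≡a = topdropIndex-first a<n
    τan′≡0 : τ a n′ ≡ 0
    τan′≡0 = topdropIndex-last 1≤a (<⇒≤ a<n)
    τa[n′∸a]≡n′ : τ a (n′ ∸ a) ≡ n′
    τa[n′∸a]≡n′ = topdropIndex-top a<n
    0≢τab : 0 ≢ τ a b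
    0≢τab 0≡ = τ-injective a<n n′<n b<n (≢-sym (<⇒≢ b<n′)) (trans τan′≡0 0≡)
    0≢τaq : 0 ≢ τ a q
    0≢τaq 0≡ = τ-injective a<n n′<n q<n (≢-sym q≢n′) (trans τan′≡0 0≡)
    a≢τab : a ≢ τ a b
    a≢τab a≡ = τ-injective a<n z<s b<n (<⇒≢ 1≤b) (trans τa0≡a a≡)
    a≢τaq : a ≢ τ a q
    a≢τaq a≡ = τ-injective a<n z<s q<n (≢-sym q≢0) (trans τa0≡a a≡)
    τab≢n′ : τ a b ≢ n′
    τab≢n′ ≡n′ = τ-injective a<n b<n n′∸a<n (λ b≡ → a+b≢n′ (trans (cong (λ t → a + t) b≡) (m+[n∸m]≡n (<⇒≤ a<n′))))
                             (trans ≡n′ (sym τa[n′∸a]≡n′))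
    τaq≢n′ : τ a q ≢ n′
    τaq≢n′ ≡n′ = τ-injective a<n q<n n′∸a<n q≢n′∸a (trans ≡n′ (sym τa[n′∸a]≡n′))

  values-unique : Unique (map proj₂ prescription)
  values-unique =
    (a≢b ∷ a≢c ∷ <⇒≢ a<n′ ∷ <⇒≢ a<n ∷ []) ∷
    (b≢c ∷ <⇒≢ b<n′ ∷ <⇒≢ b<n ∷ []) ∷
    (<⇒≢ c<n′ ∷ <⇒≢ c<n ∷ []) ∷
    (<⇒≢ n′<n ∷ []) ∷ [] ∷ []

  σ-spec : ∃ λ σ → IsPermFn n σ × All (λ (p , v) → σ p ≡ v) prescription
  σ-spec = prescribe n prescription positions-unique values-unique
    ((z<s , 1≤a , <⇒≤ a<n) ∷ (a<n , 1≤b , <⇒≤ b<n) ∷ (topdropIndex<n (<⇒≤ a<n) b<n , 1≤c , <⇒≤ c<n) ∷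
     (topdropIndex<n (<⇒≤ a<n) q<n , <-trans 1≤a a<n′ , <⇒≤ n′<n) ∷ (n′<n , s≤s z≤n , ≤-refl) ∷ [])

  σ : ℕ → ℕ
  σ = proj₁ σ-spec

  σ-perm : IsPermFn n σ
  σ-perm = proj₁ (proj₂ σ-spec)

  σ0≡a : σ 0 ≡ a
  σ0≡a = All.lookup (proj₂ (proj₂ σ-spec)) (here refl)
  σa≡b : σ a ≡ b
  σa≡b = All.lookup (proj₂ (proj₂ σ-spec)) (there (here refl))
  στab≡c : σ (τ a b) ≡ c
  στab≡c = All.lookup (proj₂ (proj₂ σ-spec)) (there (there (here refl)))
  στaq≡n′ : σ (τ a q) ≡ n′
  στaq≡n′ = All.lookup (proj₂ (proj₂ σ-spec)) (there (there (there (here refl))))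
  σn′≡n : σ n′ ≡ n
  σn′≡n = All.lookup (proj₂ (proj₂ σ-spec)) (there (there (there (there (here refl)))))

  z π : List ℕ
  z = applyUpTo σ n
  π = reverse z

  valid : TopdropValid n (necklace n a b c)
  valid = π , π-perm , 8 , period , 1 , s≤s (s≤s z≤n) , cong (rotate 1) firsts-π
    where
    z₂≡ : iterate 1 z ≡ applyUpTo (σ ∘ τ a) n
    z₂≡ = topdrop-applyUpTo σ σ0≡a (<⇒≤ a<n)
    z₃≡ : iterate 2 z ≡ applyUpTo (σ ∘ τ a ∘ τ b) n
    z₃≡ = trans (cong topdrop z₂≡) (topdrop-applyUpTo (σ ∘ τ a) (trans (cong σ (topdropIndex-first a<n)) σa≡b) (<⇒≤ b<n))
    z₄≡ : iterate 3 z ≡ applyUpTo (σ ∘ τ a ∘ τ b ∘ τ c) n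
    z₄≡ = trans (cong topdrop z₃≡) (topdrop-applyUpTo (σ ∘ τ a ∘ τ b) (trans (cong (σ ∘ τ a) (topdropIndex-first b<n)) στab≡c) (<⇒≤ c<n))
    first-z₂ : first (iterate 1 z) ≡ b
    first-z₂ = trans (cong first z₂≡) (trans (cong σ (topdropIndex-first a<n)) σa≡b)
    first-z₃ : first (iterate 2 z) ≡ c
    first-z₃ = trans (cong first z₃≡) (trans (cong (σ ∘ τ a) (topdropIndex-first b<n)) στab≡c)
    first-z₄ : first (iterate 3 z) ≡ n′
    first-z₄ = trans (cong first z₄≡) (trans (cong (σ ∘ τ a ∘ τ b) (topdropIndex-first c<n)) στaq≡n′)
    first-π : first π ≡ n
    first-π = trans (cong first (reverse-applyUpTo-reindex σ n)) σn′≡n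
    orbit : iterate 8 π ≡ π × firsts 8 π ≡ first π ∷ σ 0 ∷ first (iterate 1 z) ∷ first (iterate 2 z) ∷ first (iterate 3 z) ∷
                                                       first (iterate 2 z) ∷ first (iterate 1 z) ∷ σ 0 ∷ []
    orbit = palindromic-orbit z
      (subst (1 ≤_) (sym σ0≡a) 1≤a) (subst (1 ≤_) (sym first-z₂) 1≤b) (subst (1 ≤_) (sym first-z₃) 1≤c)
      (subst₂ _≤_ (sym (length-applyUpTo σ n)) (cong suc (sym first-π)) (n≤1+n n))
      (subst₂ _≤_ (sym (trans (cong length z₄≡) (length-applyUpTo (σ ∘ τ a ∘ τ b ∘ τ c) n))) (cong suc (sym first-z₄)) ≤-refl)
    firsts-π : firsts 8 π ≡ n ∷ a ∷ b ∷ c ∷ n′ ∷ c ∷ b ∷ a ∷ []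
    firsts-π = trans (proj₂ orbit) (cong₂ _∷_ first-π (cong₂ _∷_ σ0≡a (cong₂ _∷_ first-z₂ (cong₂ _∷_ first-z₃
      (cong₂ _∷_ first-z₄ (cong₂ _∷_ first-z₃ (cong₂ _∷_ first-z₂ (cong₂ _∷_ σ0≡a refl))))))))
    π-perm : IsPerm n π
    π-perm = ↭-trans (↭-reverse z) σ-perm
    period : IsPeriod π 8
    period = period-from-firsts (proj₁ orbit)
      (subst₂ (λ m → All (_< m)) (sym first-π) (sym (∷-injectiveʳ firsts-π))
        (a<n ∷ b<n ∷ c<n ∷ n′<n ∷ c<n ∷ b<n ∷ a<n ∷ []))

admissible⇒topdropValid : ∀ {n a b c} → Admissible n a b c → TopdropValid n (necklace n a b c)
admissible⇒topdropValid {zero} (1≤a , a≤0 , _) = contradiction (≤-trans 1≤a a≤0) λ ()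
admissible⇒topdropValid {suc zero} (1≤a , a≤0 , _) = contradiction (≤-trans 1≤a a≤0) λ ()
admissible⇒topdropValid {suc (suc _)} (1≤a , a≤ , 1≤b , b≤ , 1≤c , c≤ , a≢b , b≢c , a≢c , a+b+c≢n′ , a+b≢n′ , b+c≢n′) =
  Construction.valid 1≤a 1≤b 1≤c (s≤s a≤) (s≤s b≤) (s≤s c≤) a≢b b≢c a≢c a+b+c≢n′ a+b≢n′ b+c≢n′

-- Counting admissible triples

module _ {A : Set} where

  Unique-⊆⇒length≤ : ∀ {xs ys : List A} → Unique xs → xs ⊆ ys → length xs ≤ length ys
  Unique-⊆⇒length≤ {[]} _ _ = z≤n
  Unique-⊆⇒length≤ {x ∷ xs} {ys} (x∉xs ∷ xs-unique) xs⊆ys with us , vs , refl ← ∈-∃++ (xs⊆ys (here refl)) = begin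
    suc (length xs)              ≤⟨ s≤s (Unique-⊆⇒length≤ xs-unique xs⊆us++vs) ⟩
    suc (length (us ++ vs))      ≡⟨ cong suc (length-++ us) ⟩
    suc (length us + length vs)  ≡⟨ sym (+-suc (length us) (length vs)) ⟩
    length us + length (x ∷ vs)  ≡⟨ sym (length-++ us) ⟩
    length (us ++ x ∷ vs)        ∎
    where
    open ≤-Reasoning
    remove : ∀ {y} us → y ∈ us ++ x ∷ vs → y ≢ x → y ∈ us ++ vs
    remove [] (here refl) y≢x = contradiction refl y≢x
    remove [] (there y∈vs) _ = y∈vs
    remove (u ∷ us) (here refl) _ = here refl
    remove (u ∷ us) (there y∈) y≢x = there (remove us y∈ y≢x)
    xs⊆us++vs : xs ⊆ us ++ vs
    xs⊆us++vs y∈xs = remove us (xs⊆ys (there y∈xs)) λ { refl → All.lookup x∉xs y∈xs refl }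

  length≤filter+cover : ∀ {P : A → Set} (P? : Decidable P) {xs ys} → Unique xs →
    (∀ {x} → x ∈ xs → ¬ P x → x ∈ ys) → length xs ≤ length (filter P? xs) + length ys
  length≤filter+cover P? {xs} {ys} xs-unique cover =
    ≤-trans (Unique-⊆⇒length≤ xs-unique xs⊆) (≤-reflexive (length-++ (filter P? xs)))
    where
    xs⊆ : xs ⊆ filter P? xs ++ ys
    xs⊆ {x} x∈xs with P? x
    ... | yes px = ∈-++⁺ˡ (∈-filter⁺ P? x∈xs px)
    ... | no ¬px = ∈-++⁺ʳ (filter P? xs) (cover x∈xs ¬px)

  length-filter+rejected≤ : ∀ {P : A → Set} (P? : Decidable P) {xs ys} → Unique xs → Unique ys →
    ys ⊆ xs → All (¬_ ∘ P) ys → length (filter P? xs) + length ys ≤ length xs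
  length-filter+rejected≤ P? {xs} {ys} xs-unique ys-unique ys⊆xs ys-rejected = begin
    length (filter P? xs) + length ys   ≡⟨ sym (length-++ (filter P? xs)) ⟩
    length (filter P? xs ++ ys)         ≤⟨ Unique-⊆⇒length≤ (++⁺ (filter⁺ P? xs-unique) ys-unique disjoint) ⊆xs ⟩
    length xs                           ∎
    where
    open ≤-Reasoning
    disjoint : ∀ {v} → ¬ (v ∈ filter P? xs × v ∈ ys)
    disjoint (v∈filter , v∈ys) = All.lookup ys-rejected v∈ys (proj₂ (∈-filter⁻ P? {xs = xs} v∈filter))
    ⊆xs : filter P? xs ++ ys ⊆ xs
    ⊆xs v∈ with ∈-++⁻ (filter P? xs) v∈
    ... | inj₁ v∈filter = proj₁ (∈-filter⁻ P? {xs = xs} v∈filter)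
    ... | inj₂ v∈ys = ys⊆xs v∈ys

module _ {A B : Set} where

  length-concatMap≤ : ∀ (f : A → List B) {k} xs → (∀ {x} → x ∈ xs → length (f x) ≤ k) → length (concatMap f xs) ≤ length xs * k
  length-concatMap≤ f [] _ = z≤n
  length-concatMap≤ f {k} (x ∷ xs) bound = begin
    length (f x ++ concatMap f xs)           ≡⟨ length-++ (f x) ⟩
    length (f x) + length (concatMap f xs)   ≤⟨ +-mono-≤ (bound (here refl)) (length-concatMap≤ f xs (bound ∘ there)) ⟩
    k + length xs * k                        ∎
    where open ≤-Reasoning

  length-cartesianProduct : ∀ (xs : List A) (ys : List B) → length (cartesianProduct xs ys) ≡ length xs * length ys
  length-cartesianProduct [] ys = refl
  length-cartesianProduct (x ∷ xs) ys =
    trans (length-++ (map (x ,_) ys)) (cong₂ _+_ (length-map (x ,_) ys) (length-cartesianProduct xs ys))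

range : ℕ → List ℕ
range m = applyUpTo suc m

length-range : ∀ m → length (range m) ≡ m
length-range = length-applyUpTo suc

range-unique : ∀ m → Unique (range m)
range-unique m = applyUpTo⁺₁ suc m (λ i<j _ → <⇒≢ i<j ∘ suc-injective)

∈-range⁺ : ∀ {m x} → 1 ≤ x → x ≤ m → x ∈ range m
∈-range⁺ {x = suc x} _ x<m = ∈-applyUpTo⁺ suc x<m

∈-range⁻ : ∀ {m x} → x ∈ range m → 1 ≤ x × x ≤ m
∈-range⁻ x∈ with _ , i<m , refl ← ∈-applyUpTo⁻ suc x∈ = s≤s z≤n , i<m

⌊n/2⌋-parity : ∀ k → k ≡ ⌊ k /2⌋ + ⌊ k /2⌋ ⊎ k ≡ suc (⌊ k /2⌋ + ⌊ k /2⌋)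
⌊n/2⌋-parity zero = inj₁ refl
⌊n/2⌋-parity (suc zero) = inj₂ refl
⌊n/2⌋-parity (suc (suc k)) with ⌊n/2⌋-parity k
... | inj₁ k≡ = inj₁ (cong suc (trans (cong suc k≡) (sym (+-suc ⌊ k /2⌋ ⌊ k /2⌋))))
... | inj₂ k≡ = inj₂ (cong (suc ∘ suc) (trans k≡ (sym (+-suc ⌊ k /2⌋ ⌊ k /2⌋))))

offCentre : ℕ → List ℕ
offCentre N = filter (λ x → ¬? (x + x ≟ N)) (range (N ∸ 1))

length-offCentre : ∀ N → length (offCentre N) ≤ 2 * ⌊ N ∸ 1 /2⌋
length-offCentre zero = z≤n
length-offCentre (suc k) with ⌊n/2⌋-parity k
... | inj₁ k≡j+j = begin
  length (offCentre (suc k))  ≤⟨ length-filter _ (range k) ⟩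
  length (range k)            ≡⟨ length-range k ⟩
  k                           ≡⟨ trans k≡j+j (cong (λ t → j + t) (sym (+-identityʳ j))) ⟩
  2 * j                       ∎
  where
  j : ℕ
  j = ⌊ k /2⌋
  open ≤-Reasoning
... | inj₂ k≡1+j+j = ≤-pred (begin
  suc (length (offCentre (suc k)))   ≡⟨ +-comm 1 _ ⟩
  length (offCentre (suc k)) + 1     ≤⟨ length-filter+rejected≤ _ (range-unique k) ([] ∷ []) centre⊆ (centre-rejected ∷ []) ⟩
  length (range k)                   ≡⟨ length-range k ⟩
  k                                  ≡⟨ trans k≡1+j+j (cong (λ t → suc (j + t)) (sym (+-identityʳ j))) ⟩
  suc (2 * j)                        ∎)
  where
  j : ℕ
  j = ⌊ k /2⌋
  open ≤-Reasoning
  centre-rejected : ¬ ¬ (suc j + suc j ≡ suc k)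
  centre-rejected ¬eq = ¬eq (cong suc (trans (+-suc j j) (sym k≡1+j+j)))
  centre⊆ : (suc j ∷ []) ⊆ range k
  centre⊆ (here refl) = ∈-range⁺ (s≤s z≤n) (subst (suc j ≤_) (sym k≡1+j+j) (s≤s (m≤m+n j j)))

∈-offCentre : ∀ {x y N} → 1 ≤ x → 1 ≤ y → x ≢ y → x + y ≡ N → x ∈ offCentre N
∈-offCentre {x} {suc y} 1≤x _ x≢y refl = ∈-filter⁺ _ (∈-range⁺ 1≤x x≤x+y) (x≢y ∘ +-cancelˡ-≡ x x (suc y))
  where
  x≤x+y : x ≤ x + suc y ∸ 1
  x≤x+y = subst (x ≤_) (sym (cong (_∸ 1) (+-suc x y))) (m≤m+n x y)

Triple : Set
Triple = ℕ × ℕ × ℕ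

cube : ℕ → List Triple
cube m = cartesianProduct (range m) (cartesianProduct (range m) (range m))

cube-unique : ∀ m → Unique (cube m)
cube-unique m = cartesianProduct⁺ (range-unique m) (cartesianProduct⁺ (range-unique m) (range-unique m))

length-cube : ∀ m → length (cube m) ≡ m * (m * m)
length-cube m = begin
  length (cube m)                                                       ≡⟨ length-cartesianProduct (range m) _ ⟩
  length (range m) * length (cartesianProduct (range m) (range m))      ≡⟨ cong (length (range m) *_) (length-cartesianProduct (range m) _) ⟩
  length (range m) * (length (range m) * length (range m))              ≡⟨ cong (λ k → k * (k * k)) (length-range m) ⟩
  m * (m * m)                                                           ∎
  where open ≡-Reasoning

∈-cube⁻ : ∀ {m a b c} → (a , b , c) ∈ cube m → a ∈ range m × b ∈ range m × c ∈ range m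
∈-cube⁻ {m} abc∈ with a∈ , bc∈ ← ∈-cartesianProduct⁻ (range m) _ abc∈ with b∈ , c∈ ← ∈-cartesianProduct⁻ (range m) (range m) bc∈ =
  a∈ , b∈ , c∈

offDiagonal : ℕ → List (ℕ × ℕ)
offDiagonal m = concatMap (λ a → map (a ,_) (filter (λ b → ¬? (b ≟ a)) (range m))) (range m)

length-offDiagonal : ∀ m → length (offDiagonal m) ≤ m * (m ∸ 1)
length-offDiagonal m = ≤-trans (length-concatMap≤ _ (range m) row) (≤-reflexive (cong (_* (m ∸ 1)) (length-range m)))
  where
  row : ∀ {a} → a ∈ range m → length (map (a ,_) (filter (λ b → ¬? (b ≟ a)) (range m))) ≤ m ∸ 1
  row {a} a∈ = begin
    length (map (a ,_) (filter _ (range m)))   ≡⟨ length-map (a ,_) (filter _ (range m)) ⟩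
    length (filter _ (range m))                ≡⟨ sym (m+n∸n≡m _ 1) ⟩
    length (filter _ (range m)) + 1 ∸ 1        ≤⟨ ∸-monoˡ-≤ 1 (length-filter+rejected≤ _ (range-unique m) ([] ∷ [])
                                                                 (λ { (here refl) → a∈ }) ((λ a≢a → a≢a refl) ∷ [])) ⟩
    length (range m) ∸ 1                       ≡⟨ cong (_∸ 1) (length-range m) ⟩
    m ∸ 1                                      ∎
    where open ≤-Reasoning

∈-offDiagonal : ∀ {m a b} → a ∈ range m → b ∈ range m → a ≢ b → (a , b) ∈ offDiagonal m
∈-offDiagonal {m} {a} a∈ b∈ a≢b =
  ∈-concatMap⁺ _ (lose a∈ (∈-map⁺ (a ,_) (∈-filter⁺ (λ b → ¬? (b ≟ a)) b∈ (a≢b ∘ sym))))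

avoids : ∀ a b → Decidable (λ c → c ≢ a × c ≢ b)
avoids a b c = ¬? (c ≟ a) ×-dec ¬? (c ≟ b)

pairSumRow : ℕ → ℕ → List Triple
pairSumRow m a = map (λ c → (a , suc m ∸ a , c)) (filter (avoids a (suc m ∸ a)) (range m))

pairSumTriples : ℕ → List Triple
pairSumTriples m = concatMap (pairSumRow m) (offCentre (suc m))

length-pairSumTriples : ∀ m → length (pairSumTriples m) ≤ 2 * ⌊ m /2⌋ * (m ∸ 2)
length-pairSumTriples m = ≤-trans (length-concatMap≤ (pairSumRow m) (offCentre (suc m)) row) (*-monoˡ-≤ (m ∸ 2) (length-offCentre (suc m)))
  where
  row : ∀ {a} → a ∈ offCentre (suc m) → length (pairSumRow m a) ≤ m ∸ 2
  row {a} a∈ with a∈range , a+a≢ ← ∈-filter⁻ (λ x → ¬? (x + x ≟ suc m)) {xs = range m} a∈ = begin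
    length (pairSumRow m a)                          ≡⟨ length-map _ (filter (avoids a b) (range m)) ⟩
    length (filter (avoids a b) (range m))           ≡⟨ sym (m+n∸n≡m _ 2) ⟩
    length (filter (avoids a b) (range m)) + 2 ∸ 2   ≤⟨ ∸-monoˡ-≤ 2 (length-filter+rejected≤ _ (range-unique m) ((a≢b ∷ []) ∷ [] ∷ []) a,b⊆
                                                                       ((λ avoid → proj₁ avoid refl) ∷ (λ avoid → proj₂ avoid refl) ∷ [])) ⟩
    length (range m) ∸ 2                             ≡⟨ cong (_∸ 2) (length-range m) ⟩
    m ∸ 2                                            ∎
    where
    open ≤-Reasoning
    b : ℕ
    b = suc m ∸ a
    a≤m : a ≤ m
    a≤m = proj₂ (∈-range⁻ a∈range)
    a+b≡1+m : a + b ≡ suc m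
    a+b≡1+m = m+[n∸m]≡n (m≤n⇒m≤1+n a≤m)
    a≢b : a ≢ b
    a≢b a≡b = a+a≢ (trans (cong (λ t → a + t) a≡b) a+b≡1+m)
    a,b⊆ : (a ∷ b ∷ []) ⊆ range m
    a,b⊆ (here refl) = a∈range
    a,b⊆ (there (here refl)) = ∈-range⁺ (m<n⇒0<n∸m (s≤s a≤m)) (∸-monoʳ-≤ (suc m) (proj₁ (∈-range⁻ a∈range)))

∈-pairSumTriples : ∀ {m a b c} → a ∈ range m → b ∈ range m → c ∈ range m → a ≢ b → b ≢ c → a ≢ c → a + b ≡ suc m →
  (a , b , c) ∈ pairSumTriples m
∈-pairSumTriples {m} {a} {b} {c} a∈ b∈ c∈ a≢b b≢c a≢c a+b≡1+m = subst (λ x → (a , x , c) ∈ pairSumTriples m) 1+m∸a≡b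
  (∈-concatMap⁺ _ (lose (∈-offCentre (proj₁ (∈-range⁻ a∈)) (proj₁ (∈-range⁻ b∈)) a≢b a+b≡1+m)
    (∈-map⁺ _ (∈-filter⁺ (avoids a (suc m ∸ a)) c∈ (a≢c ∘ sym , λ c≡ → b≢c (trans (sym 1+m∸a≡b) (sym c≡)))))))
  where
  1+m∸a≡b : suc m ∸ a ≡ b
  1+m∸a≡b = trans (cong (_∸ a) (sym a+b≡1+m)) (m+n∸m≡n a b)

shift : Triple → Triple
shift (a , b , c) = (suc a , suc b , suc c)

swap₁₂ : Triple → Triple
swap₁₂ (a , b , c) = (b , a , c)

rotate₃ : Triple → Triple
rotate₃ (a , b , c) = (b , c , a)

leadingOne : ℕ → List Triple
leadingOne N = map (λ x → (1 , suc x , suc (N ∸ x))) (offCentre N)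

-- The distinct positive triples with sum N + 3 having an entry 1.
withOne : ℕ → List Triple
withOne N = leadingOne N ++ map swap₁₂ (leadingOne N) ++ map rotate₃ (leadingOne N)

-- Distinct positive triples with sum N: those with all entries ≥ 2 are shifts of triples with sum N − 3.
distinctSum : ℕ → List Triple
distinctSum (suc (suc (suc N))) = map shift (distinctSum N) ++ withOne N
distinctSum _ = []

distinctSumBound : ℕ → ℕ
distinctSumBound (suc (suc (suc N))) = distinctSumBound N + 3 * (2 * ⌊ N ∸ 1 /2⌋)
distinctSumBound _ = 0

length-distinctSum : ∀ N → length (distinctSum N) ≤ distinctSumBound N
length-distinctSum (suc (suc (suc N))) = begin
  length (map shift (distinctSum N) ++ withOne N)        ≡⟨ length-++ (map shift (distinctSum N)) ⟩
  length (map shift (distinctSum N)) + length (withOne N) ≡⟨ cong₂ _+_ (length-map shift (distinctSum N)) length-withOne ⟩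
  length (distinctSum N) + 3 * length (leadingOne N)     ≤⟨ +-mono-≤ (length-distinctSum N) (*-monoʳ-≤ 3 length-leadingOne) ⟩
  distinctSumBound N + 3 * (2 * ⌊ N ∸ 1 /2⌋)             ∎
  where
  open ≤-Reasoning
  length-leadingOne : length (leadingOne N) ≤ 2 * ⌊ N ∸ 1 /2⌋
  length-leadingOne = ≤-trans (≤-reflexive (length-map _ (offCentre N))) (length-offCentre N)
  length-withOne : length (withOne N) ≡ 3 * length (leadingOne N)
  length-withOne = begin-equality
    length (withOne N)  ≡⟨ length-++ (leadingOne N) ⟩
    length (leadingOne N) + length (map swap₁₂ (leadingOne N) ++ map rotate₃ (leadingOne N))
      ≡⟨ cong (λ t → length (leadingOne N) + t) (trans (length-++ (map swap₁₂ (leadingOne N)))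
                                                (cong₂ _+_ (length-map swap₁₂ (leadingOne N)) (length-map rotate₃ (leadingOne N)))) ⟩
    length (leadingOne N) + (length (leadingOne N) + length (leadingOne N))
      ≡⟨ cong (λ k → length (leadingOne N) + (length (leadingOne N) + k)) (sym (+-identityʳ (length (leadingOne N)))) ⟩
    3 * length (leadingOne N) ∎
length-distinctSum zero = z≤n
length-distinctSum (suc zero) = z≤n
length-distinctSum (suc (suc zero)) = z≤n

∈-leadingOne : ∀ {x y N} → 1 ≤ x → 1 ≤ y → x ≢ y → x + y ≡ N → (1 , suc x , suc y) ∈ leadingOne N
∈-leadingOne {x} {y} {N} 1≤x 1≤y x≢y x+y≡N = subst (λ z → (1 , suc x , suc z) ∈ leadingOne N) N∸x≡y
  (∈-map⁺ (λ x → (1 , suc x , suc (N ∸ x))) (∈-offCentre 1≤x 1≤y x≢y x+y≡N))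
  where
  N∸x≡y : N ∸ x ≡ y
  N∸x≡y = trans (cong (_∸ x) (sym x+y≡N)) (m+n∸m≡n x y)

∈-withOne⇒∈-distinctSum : ∀ {N t} → t ∈ withOne N → t ∈ distinctSum (3 + N)
∈-withOne⇒∈-distinctSum {N} = ∈-++⁺ʳ (map shift (distinctSum N))

∈-distinctSum : ∀ {a b c} → 1 ≤ a → 1 ≤ b → 1 ≤ c → a ≢ b → b ≢ c → a ≢ c → (a , b , c) ∈ distinctSum (a + b + c)
∈-distinctSum {1} {1} _ _ _ a≢b _ _ = contradiction refl a≢b
∈-distinctSum {1} {suc (suc _)} {1} _ _ _ _ _ a≢c = contradiction refl a≢c
∈-distinctSum {suc (suc _)} {1} {1} _ _ _ _ b≢c _ = contradiction refl b≢c
∈-distinctSum {1} {suc (suc b)} {suc (suc c)} _ _ _ _ b≢c _ =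
  ∈-withOne⇒∈-distinctSum {b + suc (suc c)} (∈-++⁺ˡ (∈-leadingOne (s≤s z≤n) (s≤s z≤n) (b≢c ∘ cong suc) (sym (+-suc b (suc c)))))
∈-distinctSum {suc (suc a)} {1} {suc (suc c)} _ _ _ _ _ a≢c =
  subst (λ N → (2 + a , 1 , 2 + c) ∈ distinctSum N) (sum≡ a c)
    (∈-withOne⇒∈-distinctSum {N} (∈-++⁺ʳ (leadingOne N) (∈-++⁺ˡ
      (∈-map⁺ swap₁₂ (∈-leadingOne (s≤s z≤n) (s≤s z≤n) (a≢c ∘ cong suc) refl)))))
  where
  N : ℕ
  N = suc a + suc c
  sum≡ : ∀ a c → 3 + (suc a + suc c) ≡ suc (suc a) + 1 + suc (suc c)
  sum≡ = solve-∀
∈-distinctSum {suc (suc a)} {suc (suc b)} {1} _ _ _ a≢b _ _ =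
  subst (λ N → (2 + a , 2 + b , 1) ∈ distinctSum N) (sum≡ a b)
    (∈-withOne⇒∈-distinctSum {N} (∈-++⁺ʳ (leadingOne N) (∈-++⁺ʳ (map swap₁₂ (leadingOne N))
      (∈-map⁺ rotate₃ (∈-leadingOne (s≤s z≤n) (s≤s z≤n) (a≢b ∘ cong suc) refl)))))
  where
  N : ℕ
  N = suc a + suc b
  sum≡ : ∀ a b → 3 + (suc a + suc b) ≡ suc (suc a) + suc (suc b) + 1
  sum≡ = solve-∀
∈-distinctSum {suc (suc a)} {suc (suc b)} {suc (suc c)} _ _ _ a≢b b≢c a≢c =
  subst (λ N → (2 + a , 2 + b , 2 + c) ∈ distinctSum N) (sum≡ a b c)
    (∈-++⁺ˡ (∈-map⁺ shift (∈-distinctSum (s≤s z≤n) (s≤s z≤n) (s≤s z≤n) (a≢b ∘ cong suc) (b≢c ∘ cong suc) (a≢c ∘ cong suc))))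
  where
  sum≡ : ∀ a b c → 3 + (suc a + suc b + suc c) ≡ suc (suc a) + suc (suc b) + suc (suc c)
  sum≡ = solve-∀

AdmissibleTriple : ℕ → Triple → Set
AdmissibleTriple n (a , b , c) = Admissible n a b c

admissible? : ∀ n → Decidable (AdmissibleTriple n)
admissible? n (a , b , c) =
  1 ≤? a ×-dec a ≤? n ∸ 2 ×-dec 1 ≤? b ×-dec b ≤? n ∸ 2 ×-dec 1 ≤? c ×-dec c ≤? n ∸ 2 ×-dec
  ¬? (a ≟ b) ×-dec ¬? (b ≟ c) ×-dec ¬? (a ≟ c) ×-dec
  ¬? (a + b + c ≟ n ∸ 1) ×-dec ¬? (a + b ≟ n ∸ 1) ×-dec ¬? (b + c ≟ n ∸ 1)

admissibleTriples : ℕ → List Triple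
admissibleTriples n = filter (admissible? n) (cube (n ∸ 2))

equal₁₂ equal₂₃ equal₁₃ : ℕ × ℕ → Triple
equal₁₂ (a , c) = (a , a , c)
equal₂₃ (a , b) = (a , b , b)
equal₁₃ (a , b) = (a , b , a)

reverse₃ : Triple → Triple
reverse₃ (a , b , c) = (c , b , a)

badFamilies : ℕ → List (List Triple)
badFamilies m =
  map equal₁₂ (cartesianProduct (range m) (range m)) ∷
  map equal₂₃ (offDiagonal m) ∷
  map equal₁₃ (offDiagonal m) ∷
  pairSumTriples m ∷
  map reverse₃ (pairSumTriples m) ∷
  distinctSum (suc m) ∷ []

badBound : ℕ → ℕ
badBound m = m * m + (m * (m ∸ 1) + (m * (m ∸ 1) + (2 * ⌊ m /2⌋ * (m ∸ 2) + (2 * ⌊ m /2⌋ * (m ∸ 2) + distinctSumBound (suc m)))))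

length-badFamilies : ∀ m → length (concat (badFamilies m)) ≤ badBound m
length-badFamilies m =
  ++-length≤ (map equal₁₂ (cartesianProduct (range m) (range m)))
    (≤-reflexive (trans (length-map equal₁₂ (cartesianProduct (range m) (range m)))
                        (trans (length-cartesianProduct (range m) (range m)) (cong (λ k → k * k) (length-range m)))))
  (++-length≤ (map equal₂₃ (offDiagonal m)) (≤-trans (≤-reflexive (length-map equal₂₃ (offDiagonal m))) (length-offDiagonal m))
  (++-length≤ (map equal₁₃ (offDiagonal m)) (≤-trans (≤-reflexive (length-map equal₁₃ (offDiagonal m))) (length-offDiagonal m))
  (++-length≤ (pairSumTriples m) (length-pairSumTriples m)
  (++-length≤ (map reverse₃ (pairSumTriples m))
    (≤-trans (≤-reflexive (length-map reverse₃ (pairSumTriples m))) (length-pairSumTriples m))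
  (≤-trans (≤-reflexive (cong length (++-identityʳ (distinctSum (suc m))))) (length-distinctSum (suc m)))))))
  where
  ++-length≤ : ∀ (xs : List Triple) {ys k l} → length xs ≤ k → length ys ≤ l → length (xs ++ ys) ≤ k + l
  ++-length≤ xs |xs|≤ |ys|≤ = ≤-trans (≤-reflexive (length-++ xs)) (+-mono-≤ |xs|≤ |ys|≤)

inadmissible⇒bad : ∀ m {t} → t ∈ cube m → ¬ AdmissibleTriple (2 + m) t → Any (t ∈_) (badFamilies m)
inadmissible⇒bad m {a , b , c} t∈ ¬adm
  with a∈ , b∈ , c∈ ← ∈-cube⁻ t∈
  with a ≟ b | b ≟ c | a ≟ c | a + b ≟ suc m | b + c ≟ suc m | a + b + c ≟ suc m
... | yes refl | _ | _ | _ | _ | _ =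
  here (∈-map⁺ equal₁₂ (∈-cartesianProduct⁺ a∈ c∈))
... | no a≢b | yes refl | _ | _ | _ | _ =
  there (here (∈-map⁺ equal₂₃ (∈-offDiagonal a∈ b∈ a≢b)))
... | no a≢b | no _ | yes refl | _ | _ | _ =
  there (there (here (∈-map⁺ equal₁₃ (∈-offDiagonal a∈ b∈ a≢b))))
... | no a≢b | no b≢c | no a≢c | yes a+b≡ | _ | _ =
  there (there (there (here (∈-pairSumTriples a∈ b∈ c∈ a≢b b≢c a≢c a+b≡))))
... | no a≢b | no b≢c | no a≢c | no _ | yes b+c≡ | _ =
  there (there (there (there (here (∈-map⁺ reverse₃
    (∈-pairSumTriples c∈ b∈ a∈ (b≢c ∘ sym) (a≢b ∘ sym) (a≢c ∘ sym) (trans (+-comm c b) b+c≡)))))))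
... | no a≢b | no b≢c | no a≢c | no _ | no _ | yes a+b+c≡ =
  there (there (there (there (there (here (subst (λ N → (a , b , c) ∈ distinctSum N) a+b+c≡
    (∈-distinctSum (proj₁ (∈-range⁻ a∈)) (proj₁ (∈-range⁻ b∈)) (proj₁ (∈-range⁻ c∈)) a≢b b≢c a≢c)))))))
... | no a≢b | no b≢c | no a≢c | no a+b≢ | no b+c≢ | no a+b+c≢ =
  contradiction (proj₁ (∈-range⁻ a∈) , proj₂ (∈-range⁻ a∈) , proj₁ (∈-range⁻ b∈) , proj₂ (∈-range⁻ b∈) ,
                 proj₁ (∈-range⁻ c∈) , proj₂ (∈-range⁻ c∈) , a≢b , b≢c , a≢c , a+b+c≢ , a+b≢ , b+c≢) ¬adm

cube≤admissible+bad : ∀ m → m * (m * m) ≤ length (admissibleTriples (2 + m)) + badBound m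
cube≤admissible+bad m = begin
  m * (m * m)
    ≡⟨ sym (length-cube m) ⟩
  length (cube m)
    ≤⟨ length≤filter+cover (admissible? (2 + m)) (cube-unique m) (λ t∈ ¬adm → ∈-concat⁺ (inadmissible⇒bad m t∈ ¬adm)) ⟩
  length (admissibleTriples (2 + m)) + length (concat (badFamilies m))
    ≤⟨ +-monoʳ-≤ _ (length-badFamilies m) ⟩
  length (admissibleTriples (2 + m)) + badBound m ∎
  where open ≤-Reasoning

-- The bound on each residue class

cubicForm : ℕ → ℕ → ℕ → ℤ
cubicForm n K₁ K₂ = ℤ._-_ (ℤ._-_ (+ 2 ℤ.* (N ℤ.* N ℤ.* N)) (+ 23 ℤ.* (N ℤ.* N)) ℤ.+ + K₁ ℤ.* N) (+ K₂)
  where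
  N : ℤ
  N = + n

linearCoefficient constantTerm : ℕ → ℕ
linearCoefficient 0 = 84
linearCoefficient 1 = 88
linearCoefficient 2 = 84
linearCoefficient 3 = 88
linearCoefficient 4 = 84
linearCoefficient _ = 88
constantTerm 0 = 92
constantTerm 1 = 115
constantTerm 2 = 92
constantTerm 3 = 111
constantTerm 4 = 96
constantTerm _ = 111

twiceLowerBound≡cubicForm : ∀ n → twiceLowerBound n ≡ cubicForm n (linearCoefficient (n % 6)) (constantTerm (n % 6))
twiceLowerBound≡cubicForm n with n % 6
... | 0 = refl
... | 1 = refl
... | 2 = refl
... | 3 = refl
... | 4 = refl
... | suc (suc (suc (suc (suc _)))) = refl

cubicForm+ : ∀ n K₁ K₂ {X Y} → 2 * (n * n * n) + K₁ * n + Y ≡ X + (23 * (n * n) + K₂) → cubicForm n K₁ K₂ ℤ.+ + Y ≡ + X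
cubicForm+ n K₁ K₂ {X} {Y} eq = begin
  cubicForm n K₁ K₂ ℤ.+ + Y                                    ≡⟨ rearrange N (+ K₁) (+ K₂) (+ Y) ⟩
  (+ 2 ℤ.* (N ℤ.* N ℤ.* N) ℤ.+ + K₁ ℤ.* N ℤ.+ + Y) ℤ.- (+ 23 ℤ.* (N ℤ.* N) ℤ.+ + K₂)
    ≡⟨ sym (cong₂ ℤ._-_ cast-lhs cast-rhs) ⟩
  + (2 * (n * n * n) + K₁ * n + Y) ℤ.- + (23 * (n * n) + K₂)  ≡⟨ cong (λ k → + k ℤ.- + (23 * (n * n) + K₂)) eq ⟩
  + (X + (23 * (n * n) + K₂)) ℤ.- + (23 * (n * n) + K₂)        ≡⟨ cong (ℤ._- + (23 * (n * n) + K₂)) (ℤ.pos-+ X _) ⟩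
  + X ℤ.+ + (23 * (n * n) + K₂) ℤ.- + (23 * (n * n) + K₂)      ≡⟨ cancel (+ X) (+ (23 * (n * n) + K₂)) ⟩
  + X                                                          ∎
  where
  open ≡-Reasoning
  N : ℤ
  N = + n
  rearrange : ∀ N K₁ K₂ Y → ℤ._-_ (ℤ._-_ (+ 2 ℤ.* (N ℤ.* N ℤ.* N)) (+ 23 ℤ.* (N ℤ.* N)) ℤ.+ K₁ ℤ.* N) K₂ ℤ.+ Y
                          ≡ (+ 2 ℤ.* (N ℤ.* N ℤ.* N) ℤ.+ K₁ ℤ.* N ℤ.+ Y) ℤ.- (+ 23 ℤ.* (N ℤ.* N) ℤ.+ K₂)
  rearrange = ℤ-Solver.solve-∀
  cancel : ∀ A B → A ℤ.+ B ℤ.- B ≡ A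
  cancel = ℤ-Solver.solve-∀
  pos-square : + (n * n) ≡ N ℤ.* N
  pos-square = ℤ.pos-* n n
  cast-lhs : + (2 * (n * n * n) + K₁ * n + Y) ≡ + 2 ℤ.* (N ℤ.* N ℤ.* N) ℤ.+ + K₁ ℤ.* N ℤ.+ + Y
  cast-lhs = begin
    + (2 * (n * n * n) + K₁ * n + Y)              ≡⟨ ℤ.pos-+ (2 * (n * n * n) + K₁ * n) Y ⟩
    + (2 * (n * n * n) + K₁ * n) ℤ.+ + Y          ≡⟨ cong (ℤ._+ + Y) (ℤ.pos-+ (2 * (n * n * n)) (K₁ * n)) ⟩
    + (2 * (n * n * n)) ℤ.+ + (K₁ * n) ℤ.+ + Y    ≡⟨ cong₂ (λ u v → u ℤ.+ v ℤ.+ + Y)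
                                                       (trans (ℤ.pos-* 2 (n * n * n)) (cong (+ 2 ℤ.*_) (trans (ℤ.pos-* (n * n) n) (cong (ℤ._* N) pos-square))))
                                                       (ℤ.pos-* K₁ n) ⟩
    + 2 ℤ.* (N ℤ.* N ℤ.* N) ℤ.+ + K₁ ℤ.* N ℤ.+ + Y ∎
  cast-rhs : + (23 * (n * n) + K₂) ≡ + 23 ℤ.* (N ℤ.* N) ℤ.+ + K₂
  cast-rhs = trans (ℤ.pos-+ (23 * (n * n)) K₂) (cong (ℤ._+ + K₂) (trans (ℤ.pos-* 23 (n * n)) (cong (+ 23 ℤ.*_) pos-square)))

⌊k+q*6/2⌋ : ∀ k q → ⌊ k + q * 6 /2⌋ ≡ ⌊ k /2⌋ + q * 3
⌊k+q*6/2⌋ k zero = trans (cong ⌊_/2⌋ (+-identityʳ k)) (sym (+-identityʳ ⌊ k /2⌋))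
⌊k+q*6/2⌋ k (suc q) = begin
  ⌊ k + (6 + q * 6) /2⌋       ≡⟨ cong ⌊_/2⌋ (+-comm-6 k (q * 6)) ⟩
  3 + ⌊ k + q * 6 /2⌋         ≡⟨ cong (λ t → 3 + t) (⌊k+q*6/2⌋ k q) ⟩
  3 + (⌊ k /2⌋ + q * 3)       ≡⟨ +-comm-3 ⌊ k /2⌋ q ⟩
  ⌊ k /2⌋ + suc q * 3         ∎
  where
  open ≡-Reasoning
  +-comm-6 : ∀ k x → k + (6 + x) ≡ 6 + (k + x)
  +-comm-6 = solve-∀
  +-comm-3 : ∀ h q → 3 + (h + q * 3) ≡ h + suc q * 3
  +-comm-3 = solve-∀

distinctSumBound-+6 : ∀ y → distinctSumBound (6 + suc y) ≡ distinctSumBound (suc y) + 6 * suc y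
distinctSumBound-+6 y = begin
  distinctSumBound (suc y) + 3 * (2 * ⌊ y /2⌋) + 3 * (2 * suc ⌈ y /2⌉)   ≡⟨ regroup (distinctSumBound (suc y)) ⌊ y /2⌋ ⌈ y /2⌉ ⟩
  distinctSumBound (suc y) + 6 * suc (⌊ y /2⌋ + ⌈ y /2⌉)                ≡⟨ cong (λ t → distinctSumBound (suc y) + 6 * suc t) (⌊n/2⌋+⌈n/2⌉≡n y) ⟩
  distinctSumBound (suc y) + 6 * suc y                                   ∎
  where
  open ≡-Reasoning
  regroup : ∀ d h h′ → d + 3 * (2 * h) + 3 * (2 * suc h′) ≡ d + 6 * suc (h + h′)
  regroup = solve-∀

distinctSumBound-+q*6 : ∀ i q → distinctSumBound (3 + i + q * 6) ≡ distinctSumBound (3 + i) + 6 * q * (3 * q + i)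
distinctSumBound-+q*6 i zero = trans (cong distinctSumBound (+-identityʳ (3 + i))) (sym (+-identityʳ _))
distinctSumBound-+q*6 i (suc q) = begin
  distinctSumBound (3 + i + (6 + q * 6))                       ≡⟨ cong distinctSumBound (+-comm-6 i (q * 6)) ⟩
  distinctSumBound (6 + suc (2 + i + q * 6))                   ≡⟨ distinctSumBound-+6 (2 + i + q * 6) ⟩
  distinctSumBound (3 + i + q * 6) + 6 * (3 + i + q * 6)        ≡⟨ cong (_+ 6 * (3 + i + q * 6)) (distinctSumBound-+q*6 i q) ⟩
  distinctSumBound (3 + i) + 6 * q * (3 * q + i) + 6 * (3 + i + q * 6)
    ≡⟨ regroup (distinctSumBound (3 + i)) i q ⟩
  distinctSumBound (3 + i) + 6 * suc q * (3 * suc q + i)        ∎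
  where
  open ≡-Reasoning
  +-comm-6 : ∀ i x → 3 + i + (6 + x) ≡ 6 + suc (2 + i + x)
  +-comm-6 = solve-∀
  regroup : ∀ d i q → d + 6 * q * (3 * q + i) + 6 * (3 + i + q * 6) ≡ d + 6 * suc q * (3 * suc q + i)
  regroup = solve-∀

-- With n = 5 + s, m = 3 + s, h = ⌊ m /2⌋ and d = distinctSumBound (1 + m), this is 2n³ − 23n² + K₁n − K₂ + 2 badBound m = 2m³
-- with the subtracted terms moved across.
Exactness : (K₁ K₂ s h d : ℕ) → Set
Exactness K₁ K₂ s h d = let n = 5 + s; m = 3 + s in
  2 * (n * n * n) + K₁ * n + 2 * (m * m + (m * (2 + s) + (m * (2 + s) + (2 * h * (1 + s) + (2 * h * (1 + s) + d))))) ≡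
  2 * (m * (m * m)) + (23 * (n * n) + K₂)

exactness : ∀ r q → let s = r + q * 6 in
  Exactness (linearCoefficient ((5 + r) % 6)) (constantTerm ((5 + r) % 6)) s (⌊ 3 + r /2⌋ + q * 3) (distinctSumBound (4 + r) + 6 * q * (3 * q + suc r)) →
  twiceLowerBound (5 + s) ℤ.+ + (2 * badBound (3 + s)) ≡ + (2 * ((3 + s) * ((3 + s) * (3 + s))))
exactness r q exact = trans (cong₂ ℤ._+_ tlb≡ (cong (λ b → + (2 * b)) badBound≡))
                             (cubicForm+ (5 + s) (linearCoefficient ((5 + r) % 6)) (constantTerm ((5 + r) % 6)) exact)
  where
  s : ℕ
  s = r + q * 6
  m : ℕ
  m = 3 + s
  tlb≡ : twiceLowerBound (5 + s) ≡ cubicForm (5 + s) (linearCoefficient ((5 + r) % 6)) (constantTerm ((5 + r) % 6))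
  tlb≡ = trans (twiceLowerBound≡cubicForm (5 + s)) (cong (λ k → cubicForm (5 + s) (linearCoefficient k) (constantTerm k)) ([m+kn]%n≡m%n (5 + r) q 6))
  badBound≡ : badBound m ≡ m * m + (m * (2 + s) + (m * (2 + s) + (2 * (⌊ 3 + r /2⌋ + q * 3) * (1 + s) +
                             (2 * (⌊ 3 + r /2⌋ + q * 3) * (1 + s) + (distinctSumBound (4 + r) + 6 * q * (3 * q + suc r))))))
  badBound≡ = cong₂ (λ h d → m * m + (m * (2 + s) + (m * (2 + s) + (2 * h * (1 + s) + (2 * h * (1 + s) + d)))))
                    (⌊k+q*6/2⌋ (3 + r) q) (distinctSumBound-+q*6 (1 + r) q)

twiceLowerBound+badBound : ∀ m → 3 ≤ m → twiceLowerBound (2 + m) ℤ.+ + (2 * badBound m) ≡ + (2 * (m * (m * m)))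
twiceLowerBound+badBound (suc (suc (suc k))) _ = subst Exact (sym (m≡m%n+[m/n]*n k 6)) (byResidue (k % 6) (k / 6) (m%n<n k 6))
  where
  Exact : ℕ → Set
  Exact s = twiceLowerBound (5 + s) ℤ.+ + (2 * badBound (3 + s)) ≡ + (2 * ((3 + s) * ((3 + s) * (3 + s))))
  byResidue : ∀ r q → r < 6 → Exact (r + q * 6)
  byResidue 0 q _ = exactness 0 q (solve [ q ])
  byResidue 1 q _ = exactness 1 q (solve [ q ])
  byResidue 2 q _ = exactness 2 q (solve [ q ])
  byResidue 3 q _ = exactness 3 q (solve [ q ])
  byResidue 4 q _ = exactness 4 q (solve [ q ])
  byResidue 5 q _ = exactness 5 q (solve [ q ])
  byResidue (suc (suc (suc (suc (suc (suc _)))))) _ (s≤s (s≤s (s≤s (s≤s (s≤s (s≤s ()))))))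
twiceLowerBound+badBound (suc (suc zero)) (s≤s (s≤s ()))
twiceLowerBound+badBound (suc zero) (s≤s ())

cancel-+-≤ : ∀ {x} y {z w} → x ℤ.+ + y ≡ + z → z ≤ w + y → x ℤ.≤ + w
cancel-+-≤ {x} y {z} {w} x+y≡z z≤w+y = begin
  x                        ≡⟨ sym (+-−-cancel x (+ y)) ⟩
  x ℤ.+ + y ℤ.- + y        ≡⟨ cong (ℤ._- + y) x+y≡z ⟩
  + z ℤ.- + y              ≤⟨ ℤ.+-monoˡ-≤ (ℤ.- + y) (ℤ.+≤+ z≤w+y) ⟩
  + (w + y) ℤ.- + y        ≡⟨ cong (ℤ._- + y) (ℤ.pos-+ w y) ⟩
  + w ℤ.+ + y ℤ.- + y      ≡⟨ +-−-cancel (+ w) (+ y) ⟩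
  + w                      ∎
  where
  open ℤ.≤-Reasoning
  +-−-cancel : ∀ a b → a ℤ.+ b ℤ.- b ≡ a
  +-−-cancel = ℤ-Solver.solve-∀

lemma4p14 : (n : ℕ) → 5 ≤ n →
    ∃ λ (L : List (ℕ × ℕ × ℕ)) →
      Unique L ×
      All (λ { (a , b , c) → Admissible n a b c × TopdropValid n (necklace n a b c) }) L ×
      twiceLowerBound n ℤ.≤ + (2 * length L)
lemma4p14 (suc (suc m)) (s≤s (s≤s 3≤m)) =
  admissibleTriples (2 + m) ,
  filter⁺ (admissible? (2 + m)) (cube-unique m) ,
  All.map (λ { {_ , _ , _} adm → adm , admissible⇒topdropValid adm }) (all-filter (admissible? (2 + m)) (cube m)) ,
  cancel-+-≤ (2 * badBound m) (twiceLowerBound+badBound m 3≤m)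
    (≤-trans (*-monoʳ-≤ 2 (cube≤admissible+bad m)) (≤-reflexive (*-distribˡ-+ 2 (length (admissibleTriples (2 + m))) (badBound m))))
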